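{- For graphs $G$ and $H$, $\mu(G\sqcup H)=\mu(G)+\mu(H)$ and $\check{\mu}(G\sqcup H)=\check{\mu}(G)+\check{\mu}(H)+i_H(G)+i_H(H)$.
   Context: All graphs are finite and simple with nonempty vertex set. By convention $K_1$ and $K_2$ are regarded as Hamiltonian (in addition to graphs with a Hamiltonian cycle). $\sqcup$ is disjoint union; $G\ast H$ is the join ($G\sqcup H$ plus all edges between $V(G)$ and $V(H)$); $K_0$ is the empty graph. A path may consist of a single vertex. An $s$-path covering of $G$ is a set of $s$ vertex-disjoint paths in $G$ containing every vertex of $G$. $\mu(G)$ is the minimum $s\in\mathbb{N}$ such that $G$ has an $s$-path covering; $\check{\mu}(G)=\min\{l\in\mathbb{N}_0: K_l\ast G\text{ is Hamiltonian}\}$; $i_H(G)=1$ if $G$ is Hamiltonian and $0$ otherwise. -}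

module Defs where

open import Data.Nat using (ℕ; zero; suc; _+_; _≤_)
open import Data.Fin using (Fin; splitAt; _≟_)
open import Data.Bool using (Bool; true; false; not)
open import Data.Sum using (_⊎_; inj₁; inj₂)
open import Data.Product using (Σ; _×_; _,_)
open import Data.List using (List; []; _∷_; length; concat; _∷ʳ_)
open import Data.List.Relation.Unary.All using (All)
open import Data.List.Relation.Unary.Linked using (Linked)
open import Data.List.Relation.Unary.Unique.Propositional using (Unique)
open import Data.List.Membership.Propositional using (_∈_)
open import Relation.Nullary using (¬_; Dec; yes; no)
open import Relation.Nullary.Decidable using (⌊_⌋)
open import Relation.Binary.PropositionalEquality using (_≡_; _≢_; refl; sym)

-- Nonemptiness (1 ≤ n) is imposed as a
-- hypothesis where needed, so that K_0 (n = 0) is also representable.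
record Graph : Set where
  field
    n     : ℕ
    adj   : Fin n → Fin n → Bool
    adj-sym : ∀ u v → adj u v ≡ adj v u
    adj-irr : ∀ v → adj v v ≡ false
open Graph public

Edge : (G : Graph) → Fin (n G) → Fin (n G) → Set
Edge G u v = adj G u v ≡ true

K-adj : ∀ l → Fin l → Fin l → Bool
K-adj l u v = not ⌊ u ≟ v ⌋

K-sym : ∀ l (u v : Fin l) → K-adj l u v ≡ K-adj l v u
K-sym l u v with u ≟ v | v ≟ u
... | yes _ | yes _ = refl
... | yes p | no q = Data.Empty.⊥-elim (q (sym p)) where import Data.Empty
... | no p | yes q = Data.Empty.⊥-elim (p (sym q)) where import Data.Empty
... | no _ | no _ = refl

K-irr : ∀ l (v : Fin l) → K-adj l v v ≡ false
K-irr l v with v ≟ v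
... | yes _ = refl
... | no p = Data.Empty.⊥-elim (p refl) where import Data.Empty

K : ℕ → Graph
K l = record { n = l ; adj = K-adj l ; adj-sym = K-sym l ; adj-irr = K-irr l }

module _ (G H : Graph) (cross : Bool) where
  sumAdj : Fin (n G) ⊎ Fin (n H) → Fin (n G) ⊎ Fin (n H) → Bool
  sumAdj (inj₁ a) (inj₁ b) = adj G a b
  sumAdj (inj₂ a) (inj₂ b) = adj H a b
  sumAdj (inj₁ _) (inj₂ _) = cross
  sumAdj (inj₂ _) (inj₁ _) = cross

  sumSym : ∀ x y → sumAdj x y ≡ sumAdj y x
  sumSym (inj₁ a) (inj₁ b) = adj-sym G a b
  sumSym (inj₂ a) (inj₂ b) = adj-sym H a b
  sumSym (inj₁ _) (inj₂ _) = refl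
  sumSym (inj₂ _) (inj₁ _) = refl

  sumIrr : ∀ x → sumAdj x x ≡ false
  sumIrr (inj₁ a) = adj-irr G a
  sumIrr (inj₂ a) = adj-irr H a

  sumGraph : Graph
  sumGraph = record
    { n = n G + n H
    ; adj = λ u v → sumAdj (splitAt (n G) u) (splitAt (n G) v)
    ; adj-sym = λ u v → sumSym (splitAt (n G) u) (splitAt (n G) v)
    ; adj-irr = λ v → sumIrr (splitAt (n G) v)
    }

_⊔_ : Graph → Graph → Graph
G ⊔ H = sumGraph G H false

_∗_ : Graph → Graph → Graph
G ∗ H = sumGraph G H true

IsPath : (G : Graph) → List (Fin (n G)) → Set
IsPath G []       = Data.Empty.⊥ where import Data.Empty
IsPath G (v ∷ vs) = Unique (v ∷ vs) × Linked (Edge G) (v ∷ vs)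

PathCovering : (G : Graph) → ℕ → Set
PathCovering G s =
  Σ (List (List (Fin (n G)))) λ ps →
    length ps ≡ s × All (IsPath G) ps × Unique (concat ps) × (∀ v → v ∈ concat ps)

HamCycle : Graph → Set
HamCycle G =
  3 ≤ n G × Σ (Fin (n G)) λ v → Σ (List (Fin (n G))) λ rest →
    Unique (v ∷ rest) × (∀ w → w ∈ (v ∷ rest)) × Linked (Edge G) ((v ∷ rest) ∷ʳ v)

Hamiltonian : Graph → Set
Hamiltonian G =
  (n G ≡ 1)
  ⊎ (n G ≡ 2 × Σ (Fin (n G)) λ u → Σ (Fin (n G)) λ v → u ≢ v × Edge G u v)
  ⊎ HamCycle G

IsMin : (ℕ → Set) → ℕ → Set
IsMin P m = P m × (∀ k → P k → m ≤ k)

IsMu : Graph → ℕ → Set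
IsMu G = IsMin (PathCovering G)

IsMuCheck : Graph → ℕ → Set
IsMuCheck G = IsMin (λ l → Hamiltonian (K l ∗ G))

IsIH : Graph → ℕ → Set
IsIH G i = (Hamiltonian G × i ≡ 1) ⊎ (¬ Hamiltonian G × i ≡ 0)

-- Paths of G ⊔ H never cross between G and H, so the path coverings of G ⊔ H are exactly
-- the unions of a path covering of G and one of H, and μ is additive.  For the second
-- identity we show μ(X) = μ̌(X) + i_H(X) for every nonempty X.  For l ≥ 1, cutting a
-- Hamiltonian cycle of K_l ∗ X at its l vertices from K_l leaves at most l paths covering X;
-- conversely l paths covering X, threaded alternately with the l vertices of K_l, form a
-- Hamiltonian cycle of K_l ∗ X.  Hence μ̌(X) = μ(X) whenever X is not Hamiltonian, while
-- μ̌(X) = 0 and μ(X) = 1 when it is.  As G ⊔ H is never Hamiltonian (a Hamiltonian path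
-- would be a 1-path covering, but it splits into coverings of G and of H),
-- μ̌(G ⊔ H) = μ(G ⊔ H) = μ(G) + μ(H) = μ̌(G) + i_H(G) + μ̌(H) + i_H(H).

module Submission where

open import Defs
open import Data.Nat using (ℕ; zero; suc; _+_; _≤_; z≤n; s≤s; _≤?_)
open import Data.Nat.Properties
  using (+-assoc; +-identityʳ; +-suc; +-mono-≤; +-commutativeSemigroup; suc-injective; n≤1+n; n≤0⇒n≡0;
         ≤-refl; ≤-trans; ≤-antisym; ≤-pred; ≰⇒>; m≤m+n)
open import Algebra.Properties.CommutativeSemigroup +-commutativeSemigroup using () renaming (interchange to +-interchange)
open import Data.Fin using (Fin; zero; suc; splitAt; _↑ˡ_; _↑ʳ_)
open import Data.Fin.Properties using (splitAt-↑ˡ; splitAt-↑ʳ; splitAt⁻¹-↑ˡ; splitAt⁻¹-↑ʳ; ↑ˡ-injective; ↑ʳ-injective; injective⇒≤)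
open import Data.Bool using (Bool; true; false)
open import Data.Sum using (_⊎_; inj₁; inj₂)
open import Data.Product using (Σ; _×_; _,_; proj₂; ∃)
open import Data.Empty using (⊥-elim)
open import Function using (_∘_)
open import Relation.Nullary using (¬_; yes; no)
open import Relation.Binary.PropositionalEquality
open import Data.List using (List; []; _∷_; _++_; _∷ʳ_; length; concat; map; lookup; allFin)
open import Data.List.Properties using (map-++; concat-map; concat-++; length-++; length-map; ++-assoc; ++-identityʳ; length-tabulate)
open import Data.List.Membership.Propositional using (_∈_)
open import Data.List.Membership.Propositional.Properties using (∈-++⁺ˡ; ∈-++⁺ʳ; ∈-++⁻; ∈-map⁺; ∈-map⁻; ∈-lookup; ∈-allFin; ∈-∃++)
open import Data.List.Relation.Unary.All using (All; []; _∷_)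
import Data.List.Relation.Unary.All as All
import Data.List.Relation.Unary.All.Properties as AllP
open import Data.List.Relation.Unary.AllPairs using ([]; _∷_)
open import Data.List.Relation.Unary.Any using (here; there)
open import Data.List.Relation.Unary.Any.Properties using (¬Any[])
open import Data.List.Relation.Unary.Linked using (Linked; []; [-]; _∷_)
import Data.List.Relation.Unary.Linked as Linked
import Data.List.Relation.Unary.Linked.Properties as LinkedP
open import Data.List.Relation.Unary.Unique.Propositional using (Unique)
import Data.List.Relation.Unary.Unique.Propositional.Properties as UniqueP
open import Data.List.Relation.Binary.Permutation.Propositional using (_↭_; ↭-refl; ↭-sym; ↭-trans; prep; ↭⇒↭ₛ; module PermutationReasoning)
open import Data.List.Relation.Binary.Permutation.Propositional.Properties using (∈-resp-↭; shift; shifts; ++⁺ˡ; ++-comm)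
import Data.List.Relation.Binary.Permutation.Setoid.Properties as PermutationₛP

module _ {A : Set} where

  Unique-++⁻ˡ : (xs : List A) {ys : List A} → Unique (xs ++ ys) → Unique xs
  Unique-++⁻ˡ []       _         = []
  Unique-++⁻ˡ (x ∷ xs) (x∉ ∷ u) = AllP.++⁻ˡ xs x∉ ∷ Unique-++⁻ˡ xs u

  Unique-++⁻ʳ : (xs : List A) {ys : List A} → Unique (xs ++ ys) → Unique ys
  Unique-++⁻ʳ []       u       = u
  Unique-++⁻ʳ (x ∷ xs) (_ ∷ u) = Unique-++⁻ʳ xs u

  Unique-resp-↭ : {xs ys : List A} → xs ↭ ys → Unique xs → Unique ys
  Unique-resp-↭ xs↭ys u = PermutationₛP.Unique-resp-↭ (setoid A) (↭⇒↭ₛ xs↭ys) u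

  lookup-injective : {xs : List A} → Unique xs → ∀ {i j} → lookup xs i ≡ lookup xs j → i ≡ j
  lookup-injective {x ∷ xs} u       {zero}  {zero}  _ = refl
  lookup-injective {x ∷ xs} u       {zero}  {suc j} e = ⊥-elim (UniqueP.Unique[x∷xs]⇒x∉xs u (subst (_∈ xs) (sym e) (∈-lookup j)))
  lookup-injective {x ∷ xs} u       {suc i} {zero}  e = ⊥-elim (UniqueP.Unique[x∷xs]⇒x∉xs u (subst (_∈ xs) e (∈-lookup i)))
  lookup-injective {x ∷ xs} (_ ∷ u) {suc i} {suc j} e = cong suc (lookup-injective u e)

  Linked-++⁻ˡ : {R : A → A → Set} (xs : List A) {ys : List A} → Linked R (xs ++ ys) → Linked R xs
  Linked-++⁻ˡ []           _        = []
  Linked-++⁻ˡ (x ∷ [])     _        = [-]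
  Linked-++⁻ˡ (x ∷ y ∷ xs) (r ∷ rs) = r ∷ Linked-++⁻ˡ (y ∷ xs) rs

  Linked-++⁻ʳ : {R : A → A → Set} (xs : List A) {ys : List A} → Linked R (xs ++ ys) → Linked R ys
  Linked-++⁻ʳ []           rs       = rs
  Linked-++⁻ʳ (x ∷ [])     [-]      = []
  Linked-++⁻ʳ (x ∷ [])     (_ ∷ rs) = rs
  Linked-++⁻ʳ (x ∷ y ∷ xs) (_ ∷ rs) = Linked-++⁻ʳ (y ∷ xs) rs

  Linked-++-∷ : {R : A → A → Set} (xs : List A) {y : A} {zs : List A} →
                Linked R (xs ++ y ∷ []) → Linked R (y ∷ zs) → Linked R (xs ++ y ∷ zs)
  Linked-++-∷ []            _        rs = rs
  Linked-++-∷ (x ∷ [])      (r ∷ _)  rs = r ∷ rs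
  Linked-++-∷ (x ∷ x′ ∷ xs) (r ∷ r′) rs = r ∷ Linked-++-∷ (x′ ∷ xs) r′ rs

  consNonEmpty : List A → List (List A) → List (List A)
  consNonEmpty []       xss = xss
  consNonEmpty (x ∷ xs) xss = (x ∷ xs) ∷ xss

  concat-consNonEmpty : (xs : List A) (xss : List (List A)) → concat (consNonEmpty xs xss) ≡ xs ++ concat xss
  concat-consNonEmpty []       _ = refl
  concat-consNonEmpty (_ ∷ _)  _ = refl

  length-consNonEmpty : (xs : List A) (xss : List (List A)) → length (consNonEmpty xs xss) ≤ suc (length xss)
  length-consNonEmpty []      xss = n≤1+n (length xss)
  length-consNonEmpty (_ ∷ _) _   = ≤-refl

Unique⇒length≤ : ∀ {l} {xs : List (Fin l)} → Unique xs → length xs ≤ l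
Unique⇒length≤ u = injective⇒≤ (lookup-injective u)

Fin-1-unique : ∀ {m} → m ≡ 1 → (x y : Fin m) → x ≡ y
Fin-1-unique refl zero zero = refl

Fin-2-cases : ∀ {m} → m ≡ 2 → {u v : Fin m} → u ≢ v → ∀ w → w ≡ u ⊎ w ≡ v
Fin-2-cases refl {zero}     {zero}     u≢v _          = ⊥-elim (u≢v refl)
Fin-2-cases refl {zero}     {suc zero} _   zero       = inj₁ refl
Fin-2-cases refl {zero}     {suc zero} _   (suc zero) = inj₂ refl
Fin-2-cases refl {suc zero} {zero}     _   zero       = inj₂ refl
Fin-2-cases refl {suc zero} {zero}     _   (suc zero) = inj₁ refl
Fin-2-cases refl {suc zero} {suc zero} u≢v _          = ⊥-elim (u≢v refl)

vertex : ∀ {m} → 1 ≤ m → Fin m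
vertex {suc _} _ = zero

PathCovering⇒1≤ : (X : Graph) → 1 ≤ n X → ∀ {k} → PathCovering X k → 1 ≤ k
PathCovering⇒1≤ X nonempty ([] , refl , _ , _ , cover) with cover (vertex nonempty)
... | ()
PathCovering⇒1≤ X nonempty (_ ∷ _ , refl , _) = s≤s z≤n

HamiltonianPathFrom : (X : Graph) → Fin (n X) → Set
HamiltonianPathFrom X u = Σ (List (Fin (n X))) λ xs → IsPath X (u ∷ xs) × (∀ w → w ∈ u ∷ xs)

HamCycle⇒HamiltonianPathFrom : (X : Graph) → HamCycle X → ∀ u → HamiltonianPathFrom X u
HamCycle⇒HamiltonianPathFrom X (_ , v , rest , unique , cover , cycle) u with ∈-∃++ (cover u)
... | [] , post , refl = post , (unique , Linked-++⁻ˡ (u ∷ post) cycle) , cover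
... | v ∷ pre , post , refl =
  post ++ v ∷ pre , (Unique-resp-↭ rotate unique , path) , λ w → ∈-resp-↭ rotate (cover w)
  where
  rotate : (v ∷ pre) ++ (u ∷ post) ↭ (u ∷ post) ++ (v ∷ pre)
  rotate = ++-comm (v ∷ pre) (u ∷ post)
  cycle′ : Linked (Edge X) ((v ∷ pre) ++ (u ∷ post) ∷ʳ v)
  cycle′ = subst (Linked (Edge X)) (++-assoc (v ∷ pre) (u ∷ post) (v ∷ [])) cycle
  path : Linked (Edge X) (u ∷ post ++ v ∷ pre)
  path = Linked-++-∷ (u ∷ post) (Linked-++⁻ʳ (v ∷ pre) cycle′) (Linked-++⁻ˡ (v ∷ pre) cycle′)

edge⇒HamiltonianPathFrom : (X : Graph) → n X ≡ 2 → ∀ {a b} → a ≢ b → Edge X a b → HamiltonianPathFrom X a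
edge⇒HamiltonianPathFrom X n≡2 {a} {b} a≢b edge = b ∷ [] , (((a≢b ∷ []) ∷ [] ∷ []) , edge ∷ [-]) , cover
  where
  cover : ∀ w → w ∈ a ∷ b ∷ []
  cover w with Fin-2-cases n≡2 a≢b w
  ... | inj₁ w≡a = here w≡a
  ... | inj₂ w≡b = there (here w≡b)

Hamiltonian⇒HamiltonianPathFrom : (X : Graph) → Hamiltonian X → ∀ u → HamiltonianPathFrom X u
Hamiltonian⇒HamiltonianPathFrom X (inj₁ n≡1) u =
  [] , ([] ∷ [] , [-]) , λ w → here (Fin-1-unique n≡1 w u)
Hamiltonian⇒HamiltonianPathFrom X (inj₂ (inj₁ (n≡2 , p , q , p≢q , edge))) u
  with Fin-2-cases n≡2 p≢q u
... | inj₁ refl = edge⇒HamiltonianPathFrom X n≡2 p≢q edge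
... | inj₂ refl = edge⇒HamiltonianPathFrom X n≡2 (p≢q ∘ sym) (trans (adj-sym X q p) edge)
Hamiltonian⇒HamiltonianPathFrom X (inj₂ (inj₂ cycle)) = HamCycle⇒HamiltonianPathFrom X cycle

Hamiltonian⇒PathCovering₁ : (X : Graph) → 1 ≤ n X → Hamiltonian X → PathCovering X 1
Hamiltonian⇒PathCovering₁ X nonempty ham with Hamiltonian⇒HamiltonianPathFrom X ham (vertex nonempty)
... | xs , path@(unique , _) , cover =
  (vertex nonempty ∷ xs) ∷ [] , refl , path ∷ [] ,
  subst Unique (sym (++-identityʳ _)) unique , λ w → subst (w ∈_) (sym (++-identityʳ _)) (cover w)

module SumVertices (m n : ℕ) where

  inl : Fin m → Fin (m + n)
  inl a = a ↑ˡ n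

  inr : Fin n → Fin (m + n)
  inr b = m ↑ʳ b

  inl-injective : ∀ {a a′} → inl a ≡ inl a′ → a ≡ a′
  inl-injective = ↑ˡ-injective n _ _

  inr-injective : ∀ {b b′} → inr b ≡ inr b′ → b ≡ b′
  inr-injective = ↑ʳ-injective m _ _

  inl≢inr : ∀ a b → inl a ≢ inr b
  inl≢inr a b e with trans (sym (splitAt-↑ˡ m a n)) (trans (cong (splitAt m) e) (splitAt-↑ʳ m n b))
  ... | ()

  data Side : Fin (m + n) → Set where
    left  : ∀ a → Side (inl a)
    right : ∀ b → Side (inr b)

  side : ∀ x → Side x
  side x with splitAt m x in eq
  ... | inj₁ a = subst Side (splitAt⁻¹-↑ˡ eq) (left a)
  ... | inj₂ b = subst Side (splitAt⁻¹-↑ʳ eq) (right b)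

  infixr 5 _⊕_

  _⊕_ : List (Fin m) → List (Fin n) → List (Fin (m + n))
  as ⊕ bs = map inl as ++ map inr bs

  ⊕-Unique⁺ : ∀ {as bs} → Unique as → Unique bs → Unique (as ⊕ bs)
  ⊕-Unique⁺ ua ub = UniqueP.++⁺ (UniqueP.map⁺ inl-injective ua) (UniqueP.map⁺ inr-injective ub) disjoint
    where
    disjoint : ∀ {v} → ¬ (v ∈ map inl _ × v ∈ map inr _)
    disjoint (v∈l , v∈r) with ∈-map⁻ inl v∈l | ∈-map⁻ inr v∈r
    ... | a , _ , refl | b , _ , e = inl≢inr a b e

  ⊕-Unique⁻ˡ : ∀ as {bs} → Unique (as ⊕ bs) → Unique as
  ⊕-Unique⁻ˡ as u = UniqueP.map⁻ (Unique-++⁻ˡ (map inl as) u)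

  ⊕-Unique⁻ʳ : ∀ as {bs} → Unique (as ⊕ bs) → Unique bs
  ⊕-Unique⁻ʳ as u = UniqueP.map⁻ (Unique-++⁻ʳ (map inl as) u)

  ∈-⊕⁻ˡ : ∀ as {bs a} → inl a ∈ as ⊕ bs → a ∈ as
  ∈-⊕⁻ˡ as a∈ with ∈-++⁻ (map inl as) a∈
  ... | inj₁ a∈l = let (a′ , a′∈ , e) = ∈-map⁻ inl a∈l in subst (_∈ as) (sym (inl-injective e)) a′∈
  ... | inj₂ a∈r = let (b , _ , e) = ∈-map⁻ inr a∈r in ⊥-elim (inl≢inr _ b e)

  ∈-⊕⁻ʳ : ∀ as {bs b} → inr b ∈ as ⊕ bs → b ∈ bs
  ∈-⊕⁻ʳ as b∈ with ∈-++⁻ (map inl as) b∈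
  ... | inj₁ b∈l = let (a , _ , e) = ∈-map⁻ inl b∈l in ⊥-elim (inl≢inr a _ (sym e))
  ... | inj₂ b∈r = let (b′ , b′∈ , e) = ∈-map⁻ inr b∈r in subst (_∈ _) (sym (inr-injective e)) b′∈

  ⊕-complete : ∀ {as bs} → (∀ a → a ∈ as) → (∀ b → b ∈ bs) → ∀ x → x ∈ as ⊕ bs
  ⊕-complete all-a all-b x with side x
  ... | left a  = ∈-++⁺ˡ (∈-map⁺ inl (all-a a))
  ... | right b = ∈-++⁺ʳ _ (∈-map⁺ inr (all-b b))

module SumGraph (A B : Graph) (cross : Bool) where

  S : Graph
  S = sumGraph A B cross

  open SumVertices (n A) (n B) public

  adj-inl-inl : ∀ a a′ → adj S (inl a) (inl a′) ≡ adj A a a′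
  adj-inl-inl a a′ = cong₂ (sumAdj A B cross) (splitAt-↑ˡ (n A) a (n B)) (splitAt-↑ˡ (n A) a′ (n B))

  adj-inr-inr : ∀ b b′ → adj S (inr b) (inr b′) ≡ adj B b b′
  adj-inr-inr b b′ = cong₂ (sumAdj A B cross) (splitAt-↑ʳ (n A) (n B) b) (splitAt-↑ʳ (n A) (n B) b′)

  adj-inl-inr : ∀ a b → adj S (inl a) (inr b) ≡ cross
  adj-inl-inr a b = cong₂ (sumAdj A B cross) (splitAt-↑ˡ (n A) a (n B)) (splitAt-↑ʳ (n A) (n B) b)

  adj-inr-inl : ∀ b a → adj S (inr b) (inl a) ≡ cross
  adj-inr-inl b a = cong₂ (sumAdj A B cross) (splitAt-↑ʳ (n A) (n B) b) (splitAt-↑ˡ (n A) a (n B))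

  IsPath-map-inl⁺ : ∀ {p} → IsPath A p → IsPath S (map inl p)
  IsPath-map-inl⁺ {_ ∷ _} (u , l) =
    UniqueP.map⁺ inl-injective u , LinkedP.map⁺ (Linked.map (λ e → trans (adj-inl-inl _ _) e) l)

  IsPath-map-inl⁻ : ∀ {p} → IsPath S (map inl p) → IsPath A p
  IsPath-map-inl⁻ {_ ∷ _} (u , l) =
    UniqueP.map⁻ u , Linked.map (λ e → trans (sym (adj-inl-inl _ _)) e) (LinkedP.map⁻ l)

  IsPath-map-inr⁺ : ∀ {q} → IsPath B q → IsPath S (map inr q)
  IsPath-map-inr⁺ {_ ∷ _} (u , l) =
    UniqueP.map⁺ inr-injective u , LinkedP.map⁺ (Linked.map (λ e → trans (adj-inr-inr _ _) e) l)

  IsPath-map-inr⁻ : ∀ {q} → IsPath S (map inr q) → IsPath B q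
  IsPath-map-inr⁻ {_ ∷ _} (u , l) =
    UniqueP.map⁻ u , Linked.map (λ e → trans (sym (adj-inr-inr _ _)) e) (LinkedP.map⁻ l)

module DisjointUnion (G H : Graph) where

  open SumGraph G H false public

  ¬Edge-inl-inr : ∀ a b → ¬ Edge S (inl a) (inr b)
  ¬Edge-inl-inr a b e with trans (sym e) (adj-inl-inr a b)
  ... | ()

  ¬Edge-inr-inl : ∀ b a → ¬ Edge S (inr b) (inl a)
  ¬Edge-inr-inl b a e with trans (sym e) (adj-inr-inl b a)
  ... | ()

  Linked-one-side : ∀ x xs → Linked (Edge S) (x ∷ xs) →
    (∃ λ p → x ∷ xs ≡ map inl p) ⊎ (∃ λ q → x ∷ xs ≡ map inr q)
  Linked-one-side x [] _ with side x
  ... | left a  = inj₁ (a ∷ [] , refl)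
  ... | right b = inj₂ (b ∷ [] , refl)
  Linked-one-side x (y ∷ ys) (e ∷ l) with side x | Linked-one-side y ys l
  ... | left a  | inj₁ (p , eq)          = inj₁ (a ∷ p , cong (inl a ∷_) eq)
  ... | right b | inj₂ (q , eq)          = inj₂ (b ∷ q , cong (inr b ∷_) eq)
  ... | left a  | inj₂ (b ∷ _ , refl)    = ⊥-elim (¬Edge-inl-inr a b e)
  ... | right b | inj₁ (a ∷ _ , refl)    = ⊥-elim (¬Edge-inr-inl b a e)

  partitionPaths : ∀ ps → All (IsPath S) ps →
    Σ (List (List (Fin (n G)))) λ psG → Σ (List (List (Fin (n H)))) λ psH →
      length psG + length psH ≡ length ps × All (IsPath G) psG × All (IsPath H) psH ×
      concat ps ↭ concat psG ⊕ concat psH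
  partitionPaths [] [] = [] , [] , refl , [] , [] , ↭-refl
  partitionPaths ((x ∷ xs) ∷ ps) (path ∷ paths)
    with partitionPaths ps paths | Linked-one-side x xs (proj₂ path)
  ... | psG , psH , len , pathsG , pathsH , ↭ps | inj₁ (p , eq) =
    p ∷ psG , psH , cong suc len , IsPath-map-inl⁻ (subst (IsPath S) eq path) ∷ pathsG , pathsH ,
    subst (λ xs → xs ++ concat ps ↭ concat (p ∷ psG) ⊕ concat psH) (sym eq) (begin
      map inl p ++ concat ps                             ↭⟨ ++⁺ˡ (map inl p) ↭ps ⟩
      map inl p ++ concat psG ⊕ concat psH               ≡⟨ sym (++-assoc (map inl p) _ _) ⟩
      (map inl p ++ map inl (concat psG)) ++ map inr (concat psH)
                                                          ≡⟨ cong (_++ map inr (concat psH)) (sym (map-++ inl p (concat psG))) ⟩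
      concat (p ∷ psG) ⊕ concat psH                      ∎)
    where open PermutationReasoning
  ... | psG , psH , len , pathsG , pathsH , ↭ps | inj₂ (q , eq) =
    psG , q ∷ psH , trans (+-suc (length psG) (length psH)) (cong suc len) , pathsG ,
    IsPath-map-inr⁻ (subst (IsPath S) eq path) ∷ pathsH ,
    subst (λ xs → xs ++ concat ps ↭ concat psG ⊕ concat (q ∷ psH)) (sym eq) (begin
      map inr q ++ concat ps                             ↭⟨ ++⁺ˡ (map inr q) ↭ps ⟩
      map inr q ++ map inl (concat psG) ++ map inr (concat psH)
                                                          ↭⟨ shifts (map inr q) (map inl (concat psG)) ⟩
      map inl (concat psG) ++ map inr q ++ map inr (concat psH)
                                                          ≡⟨ cong (map inl (concat psG) ++_) (sym (map-++ inr q (concat psH))) ⟩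
      concat psG ⊕ concat (q ∷ psH)                      ∎)
    where open PermutationReasoning

  ⊔-covering⁺ : ∀ {a b} → PathCovering G a → PathCovering H b → PathCovering (G ⊔ H) (a + b)
  ⊔-covering⁺ (ps , refl , pathsG , uniqueG , coverG) (qs , refl , pathsH , uniqueH , coverH) =
    map (map inl) ps ++ map (map inr) qs ,
    trans (length-++ (map (map inl) ps)) (cong₂ _+_ (length-map (map inl) ps) (length-map (map inr) qs)) ,
    AllP.++⁺ (AllP.map⁺ (All.map IsPath-map-inl⁺ pathsG))
             (AllP.map⁺ (All.map IsPath-map-inr⁺ pathsH)) ,
    subst Unique (sym concat≡) (⊕-Unique⁺ uniqueG uniqueH) ,
    λ x → subst (x ∈_) (sym concat≡) (⊕-complete coverG coverH x)
    where
    concat≡ : concat (map (map inl) ps ++ map (map inr) qs) ≡ concat ps ⊕ concat qs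
    concat≡ = trans (sym (concat-++ (map (map inl) ps) _)) (cong₂ _++_ (concat-map ps) (concat-map qs))

  ⊔-covering⁻ : ∀ {k} → PathCovering (G ⊔ H) k →
    Σ ℕ λ a → Σ ℕ λ b → a + b ≡ k × PathCovering G a × PathCovering H b
  ⊔-covering⁻ (ps , refl , paths , unique , cover) with partitionPaths ps paths
  ... | psG , psH , len , pathsG , pathsH , ↭ps =
    length psG , length psH , len ,
    (psG , refl , pathsG , ⊕-Unique⁻ˡ (concat psG) unique′ , λ a → ∈-⊕⁻ˡ (concat psG) (∈-resp-↭ ↭ps (cover (inl a)))) ,
    (psH , refl , pathsH , ⊕-Unique⁻ʳ (concat psG) unique′ , λ b → ∈-⊕⁻ʳ (concat psG) (∈-resp-↭ ↭ps (cover (inr b))))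
    where
    unique′ : Unique (concat psG ⊕ concat psH)
    unique′ = Unique-resp-↭ ↭ps unique

  ⊔-nonempty : 1 ≤ n G → 1 ≤ n (G ⊔ H)
  ⊔-nonempty nonemptyG = ≤-trans nonemptyG (m≤m+n (n G) (n H))

  ⊔-¬Hamiltonian : 1 ≤ n G → 1 ≤ n H → ¬ Hamiltonian (G ⊔ H)
  ⊔-¬Hamiltonian nonemptyG nonemptyH ham
    with ⊔-covering⁻ (Hamiltonian⇒PathCovering₁ (G ⊔ H) (⊔-nonempty nonemptyG) ham)
  ... | a , b , a+b≡1 , coverG , coverH
    with subst (2 ≤_) a+b≡1 (+-mono-≤ (PathCovering⇒1≤ G nonemptyG coverG) (PathCovering⇒1≤ H nonemptyH coverH))
  ... | s≤s ()

  IsMu-⊔ : ∀ a b → IsMu G a → IsMu H b → IsMu (G ⊔ H) (a + b)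
  IsMu-⊔ a b (coverG , minimalG) (coverH , minimalH) = ⊔-covering⁺ coverG coverH , minimal
    where
    minimal : ∀ k → PathCovering (G ⊔ H) k → a + b ≤ k
    minimal k cover with ⊔-covering⁻ cover
    ... | k₁ , k₂ , k₁+k₂≡k , coverG′ , coverH′ =
      subst (a + b ≤_) k₁+k₂≡k (+-mono-≤ (minimalG k₁ coverG′) (minimalH k₂ coverH′))

module Join (l : ℕ) (X : Graph) where

  open SumGraph (K l) X true public

  Edge-inl-inr : ∀ k b → Edge S (inl k) (inr b)
  Edge-inl-inr = adj-inl-inr

  Edge-inr-inl : ∀ b k → Edge S (inr b) (inl k)
  Edge-inr-inl = adj-inr-inl

  interleave : List (Fin l) → List (List (Fin (n X))) → List (Fin (l + n X))
  interleave (k ∷ ks) (p ∷ ps) = inl k ∷ map inr p ++ interleave ks ps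
  interleave _        _        = []

  interleave-↭ : ∀ ks ps → length ks ≡ length ps → interleave ks ps ↭ ks ⊕ concat ps
  interleave-↭ []       []       _   = ↭-refl
  interleave-↭ (k ∷ ks) (p ∷ ps) len = prep (inl k) (begin
    map inr p ++ interleave ks ps                       ↭⟨ ++⁺ˡ (map inr p) (interleave-↭ ks ps (suc-injective len)) ⟩
    map inr p ++ map inl ks ++ map inr (concat ps)      ↭⟨ shifts (map inr p) (map inl ks) ⟩
    map inl ks ++ map inr p ++ map inr (concat ps)      ≡⟨ cong (map inl ks ++_) (sym (map-++ inr p (concat ps))) ⟩
    ks ⊕ concat (p ∷ ps)                                ∎)
    where open PermutationReasoning

  StartsInK : List (Fin (l + n X)) → Set
  StartsInK xs = ∃ λ k → ∃ λ ys → xs ≡ inl k ∷ ys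

  interleave-++-StartsInK : ∀ ks ps {xs} → StartsInK xs → StartsInK (interleave ks ps ++ xs)
  interleave-++-StartsInK (k ∷ ks) (p ∷ ps) _  = k , _ , refl
  interleave-++-StartsInK []       _        s = s
  interleave-++-StartsInK (_ ∷ _)  []       s = s

  Linked-map-inr-++ : ∀ b p xs → Linked (Edge X) (b ∷ p) → Linked (Edge S) xs → StartsInK xs →
                      Linked (Edge S) (map inr (b ∷ p) ++ xs)
  Linked-map-inr-++ b []       _ _        l (k , _ , refl) = Edge-inr-inl b k ∷ l
  Linked-map-inr-++ b (b′ ∷ p) xs (e ∷ lp) l s             = trans (adj-inr-inr b b′) e ∷ Linked-map-inr-++ b′ p xs lp l s

  Linked-interleave-++ : ∀ ks ps → All (IsPath X) ps → ∀ {xs} → Linked (Edge S) xs → StartsInK xs →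
                         Linked (Edge S) (interleave ks ps ++ xs)
  Linked-interleave-++ []       _  _ l _ = l
  Linked-interleave-++ (_ ∷ _)  [] _ l _ = l
  Linked-interleave-++ (k ∷ ks) ((b ∷ p) ∷ ps) ((_ , lp) ∷ paths) {xs} l s =
    Edge-inl-inr k b ∷ subst (Linked (Edge S)) (sym (++-assoc (map inr (b ∷ p)) (interleave ks ps) xs))
      (Linked-map-inr-++ b p _ lp (Linked-interleave-++ ks ps paths l s) (interleave-++-StartsInK ks ps s))

  interleave⇒Hamiltonian : ∀ ks ps → length ks ≡ length ps → All (IsPath X) ps →
    Unique (ks ⊕ concat ps) → (∀ x → x ∈ ks ⊕ concat ps) → 1 ≤ l → 1 ≤ n X → Hamiltonian S
  interleave⇒Hamiltonian [] [] _ _ _ cover nonemptyK _ with cover (inl (vertex nonemptyK))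
  ... | ()
  interleave⇒Hamiltonian (k ∷ ks) (p ∷ ps) len paths unique cover nonemptyK nonemptyX with 3 ≤? l + n X
  ... | yes 3≤n = inj₂ (inj₂ (3≤n , inl k , map inr p ++ interleave ks ps ,
          Unique-resp-↭ (↭-sym ↭ks) unique , (λ x → ∈-resp-↭ (↭-sym ↭ks) (cover x)) ,
          Linked-interleave-++ (k ∷ ks) (p ∷ ps) paths [-] (k , [] , refl)))
    where ↭ks = interleave-↭ (k ∷ ks) (p ∷ ps) len
  -- With fewer than 3 vertices the join is K₂ (l = n X = 1).
  ... | no 3≰n = inj₂ (inj₁ (n≡2 , inl k , inr (vertex nonemptyX) , inl≢inr k _ , Edge-inl-inr k _))
    where n≡2 = ≤-antisym (≤-pred (≰⇒> 3≰n)) (+-mono-≤ nonemptyK nonemptyX)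

  PathCovering⇒Hamiltonian : 1 ≤ n X → PathCovering X l → Hamiltonian S
  PathCovering⇒Hamiltonian nonemptyX covering@(ps , len , paths , unique , cover) =
    interleave⇒Hamiltonian (allFin l) ps (trans (length-tabulate _) (sym len)) paths
      (⊕-Unique⁺ (UniqueP.allFin⁺ l) unique) (⊕-complete ∈-allFin cover)
      (PathCovering⇒1≤ X nonemptyX covering) nonemptyX

  kVertices : List (Fin (l + n X)) → List (Fin l)
  kVertices []       = []
  kVertices (x ∷ xs) with side x
  ... | left k  = k ∷ kVertices xs
  ... | right _ = kVertices xs

  leadingRun : List (Fin (l + n X)) → List (Fin (n X))
  leadingRun []       = []
  leadingRun (x ∷ xs) with side x
  ... | left _  = []
  ... | right b = b ∷ leadingRun xs

  -- The maximal nonempty runs of X-vertices that follow a vertex of K l.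
  laterRuns : List (Fin (l + n X)) → List (List (Fin (n X)))
  laterRuns []       = []
  laterRuns (x ∷ xs) with side x
  ... | left _  = consNonEmpty (leadingRun xs) (laterRuns xs)
  ... | right _ = laterRuns xs

  runs-↭ : ∀ xs → xs ↭ kVertices xs ⊕ (leadingRun xs ++ concat (laterRuns xs))
  runs-↭ []       = ↭-refl
  runs-↭ (x ∷ xs) with side x
  ... | left k  = prep (inl k) (subst (λ ys → xs ↭ kVertices xs ⊕ ys)
                    (sym (concat-consNonEmpty (leadingRun xs) (laterRuns xs))) (runs-↭ xs))
  ... | right b = ↭-trans (prep (inr b) (runs-↭ xs)) (↭-sym (shift (inr b) (map inl (kVertices xs)) _))

  length-laterRuns : ∀ xs → length (laterRuns xs) ≤ length (kVertices xs)
  length-laterRuns []       = z≤n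
  length-laterRuns (x ∷ xs) with side x
  ... | left _  = ≤-trans (length-consNonEmpty (leadingRun xs) (laterRuns xs)) (s≤s (length-laterRuns xs))
  ... | right _ = length-laterRuns xs

  leadingRun-inl : ∀ k xs → leadingRun (inl k ∷ xs) ≡ []
  leadingRun-inl k xs = go (inl k) refl
    where
    go : ∀ x → x ≡ inl k → leadingRun (x ∷ xs) ≡ []
    go x x≡inl with side x
    ... | left _  = refl
    ... | right b = ⊥-elim (inl≢inr k b (sym x≡inl))

  Linked-leadingRun : ∀ xs → Linked (Edge S) xs → Linked (Edge X) (leadingRun xs)
  Linked-leadingRun []           _        = []
  Linked-leadingRun (x ∷ [])     _        with side x
  ... | left _  = []
  ... | right _ = [-]
  Linked-leadingRun (x ∷ y ∷ ys) (e ∷ l)  with side x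
  ... | left _  = []
  ... | right b with side y | Linked-leadingRun (y ∷ ys) l
  ...   | left _  | _ = [-]
  ...   | right c | r = trans (sym (adj-inr-inr b c)) e ∷ r

  consNonEmpty-IsPath : ∀ {xs xss} → Linked (Edge X) xs → Unique xs → All (IsPath X) xss →
                        All (IsPath X) (consNonEmpty xs xss)
  consNonEmpty-IsPath {[]}    _ _ paths = paths
  consNonEmpty-IsPath {_ ∷ _} l u paths = (u , l) ∷ paths

  laterRuns-IsPath : ∀ xs → Linked (Edge S) xs → Unique (concat (laterRuns xs)) → All (IsPath X) (laterRuns xs)
  laterRuns-IsPath []       _ _ = []
  laterRuns-IsPath (x ∷ xs) l u with side x
  ... | right _ = laterRuns-IsPath xs (Linked.tail l) u
  ... | left _  = consNonEmpty-IsPath (Linked-leadingRun xs (Linked.tail l)) (Unique-++⁻ˡ (leadingRun xs) u′)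
                    (laterRuns-IsPath xs (Linked.tail l) (Unique-++⁻ʳ (leadingRun xs) u′))
    where u′ = subst Unique (concat-consNonEmpty (leadingRun xs) (laterRuns xs)) u

  HamiltonianPathFromK⇒PathCovering : ∀ k → HamiltonianPathFrom S (inl k) →
    Σ ℕ λ c → c ≤ l × PathCovering X c
  HamiltonianPathFromK⇒PathCovering k (xs , (unique , linked) , cover) =
    length (laterRuns path) ,
    ≤-trans (length-laterRuns path) (Unique⇒length≤ (⊕-Unique⁻ˡ (kVertices path) unique′)) ,
    laterRuns path , refl , laterRuns-IsPath path linked uniqueRuns , uniqueRuns , coverRuns
    where
    path = inl k ∷ xs
    unique′ : Unique (kVertices path ⊕ (leadingRun path ++ concat (laterRuns path)))
    unique′ = Unique-resp-↭ (runs-↭ path) unique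
    uniqueRuns : Unique (concat (laterRuns path))
    uniqueRuns = Unique-++⁻ʳ (leadingRun path) (⊕-Unique⁻ʳ (kVertices path) unique′)
    coverRuns : ∀ b → b ∈ concat (laterRuns path)
    coverRuns b with ∈-++⁻ (leadingRun path) (∈-⊕⁻ʳ (kVertices path) (∈-resp-↭ (runs-↭ path) (cover (inr b))))
    ... | inj₁ b∈leading = ⊥-elim (¬Any[] (subst (b ∈_) (leadingRun-inl k xs) b∈leading))
    ... | inj₂ b∈later   = b∈later

  Hamiltonian⇒PathCovering : 1 ≤ l → Hamiltonian S → Σ ℕ λ c → c ≤ l × PathCovering X c
  Hamiltonian⇒PathCovering nonemptyK ham =
    HamiltonianPathFromK⇒PathCovering k (Hamiltonian⇒HamiltonianPathFrom S ham (inl k))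
    where k = vertex nonemptyK

IsMu-Hamiltonian : (X : Graph) → 1 ≤ n X → Hamiltonian X → IsMu X 1
IsMu-Hamiltonian X nonempty ham = Hamiltonian⇒PathCovering₁ X nonempty ham , λ _ → PathCovering⇒1≤ X nonempty

-- For k = 0 the hypothesis ¬ Hamiltonian X applies because K 0 ∗ X is definitionally X.
module NonHamiltonian (X : Graph) (nonempty : 1 ≤ n X) (¬ham : ¬ Hamiltonian X) where

  ≤-Hamiltonian-join : ∀ {m} → (∀ c → PathCovering X c → m ≤ c) → ∀ k → Hamiltonian (K k ∗ X) → m ≤ k
  ≤-Hamiltonian-join _       zero    ham = ⊥-elim (¬ham ham)
  ≤-Hamiltonian-join minimal (suc k) ham with Join.Hamiltonian⇒PathCovering (suc k) X (s≤s z≤n) ham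
  ... | c , c≤k , cover = ≤-trans (minimal c cover) c≤k

  IsMu⇒IsMuCheck : ∀ {m} → IsMu X m → IsMuCheck X m
  IsMu⇒IsMuCheck (cover , minimal) =
    Join.PathCovering⇒Hamiltonian _ X nonempty cover , ≤-Hamiltonian-join minimal

  IsMuCheck⇒IsMu : ∀ {m} → IsMuCheck X m → IsMu X m
  IsMuCheck⇒IsMu {zero}  (ham , _)       = ⊥-elim (¬ham ham)
  IsMuCheck⇒IsMu {suc m} (ham , minimal) with Join.Hamiltonian⇒PathCovering (suc m) X (s≤s z≤n) ham
  ... | c , c≤m , cover = subst (PathCovering X) (≤-antisym c≤m (minimal c (join cover))) cover ,
                          λ k cover′ → minimal k (join cover′)
    where
    join : ∀ {k} → PathCovering X k → Hamiltonian (K k ∗ X)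
    join = Join.PathCovering⇒Hamiltonian _ X nonempty

IsMuCheck+IsIH⇒IsMu : (X : Graph) → 1 ≤ n X → ∀ {a i} → IsMuCheck X a → IsIH X i → IsMu X (a + i)
IsMuCheck+IsIH⇒IsMu X nonempty (_ , minimal) (inj₁ (ham , refl)) with n≤0⇒n≡0 (minimal 0 ham)
... | refl = IsMu-Hamiltonian X nonempty ham
IsMuCheck+IsIH⇒IsMu X nonempty {a} μ̌ (inj₂ (¬ham , refl)) =
  subst (IsMu X) (sym (+-identityʳ a)) (NonHamiltonian.IsMuCheck⇒IsMu X nonempty ¬ham μ̌)

lemma2p4 : (G H : Graph) → 1 ≤ n G → 1 ≤ n H →
    (∀ a b → IsMu G a → IsMu H b → IsMu (G ⊔ H) (a + b))
    × (∀ a b i j → IsMuCheck G a → IsMuCheck H b → IsIH G i → IsIH H j →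
         IsMuCheck (G ⊔ H) (a + b + i + j))
lemma2p4 G H nonemptyG nonemptyH = IsMu-⊔ , μ̌-⊔
  where
  open DisjointUnion G H
  μ̌-⊔ : ∀ a b i j → IsMuCheck G a → IsMuCheck H b → IsIH G i → IsIH H j →
        IsMuCheck (G ⊔ H) (a + b + i + j)
  μ̌-⊔ a b i j μ̌G μ̌H iG iH =
    subst (IsMuCheck (G ⊔ H)) (trans (+-interchange a i b j) (sym (+-assoc (a + b) i j)))
      (NonHamiltonian.IsMu⇒IsMuCheck (G ⊔ H) (⊔-nonempty nonemptyG) (⊔-¬Hamiltonian nonemptyG nonemptyH)
        (IsMu-⊔ (a + i) (b + j) (IsMuCheck+IsIH⇒IsMu G nonemptyG μ̌G iG) (IsMuCheck+IsIH⇒IsMu H nonemptyH μ̌H iH)))
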